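{- Let $\mathcal{M}^{in}$ be a transversal matroid on $E$ given by a bipartite graph between $E$ and $V$, let $p\in[0,1]^E$ and $x\in[0,1]^E$ with $p\cdot x\in\mathcal{P}(\mathcal{M}^{in})$. Let $p\cdot x=\sum_{i=1}^m\beta_i\mathbf{1}_{B_i}$ with $B_1,\dots,B_m$ independent sets of $\mathcal{M}^{in}$, $\beta_i\ge0$, $\sum_i\beta_i=1$, and for each $B_i$ fix a matching injection $v^{B_i}:B_i\to V$. For sets $A,B$ among the $B_i$ define $\phi[B,A]:B\to A\cup\{\perp\}$ by $\phi[B,A](b)=a$ if $a\in A$ satisfies $v^{A}(a)=v^{B}(b)$, and $\phi[B,A](b)=\perp$ if no such $a$ exists. For every $f\in E$ with $p_fx_f>0$, independently choose an index $c(f)$, with $c(f)=i$ with probability $\beta_i/(p_fx_f)$ among the $i$ with $f\in B_i$ (the $f$-critical set is $B_{c(f)}$), independently of $R(x)$. For $e$ with $p_ex_e>0$ let $\Gamma(e)=\{f\neq e:\ p_fx_f>0,\ \phi[B_{c(f)},B_{c(e)}](f)=e\}$. Then for every such element $e$, $$\mathbb{E}_{\mathcal{C},R(x)}\Big[\sum_{f\in\Gamma(e)}p_f\cdot\mathbf{1}[f\in R(x)]\Big]\le1,$$ where the expectation is over $R(x)$ and the choice of critical sets $\mathcal{C}=(c(f))_f$.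
   Context: Transversal matroid: given a bipartite graph with sides $E$ and $V$, a set $S\subseteq E$ is independent iff there is an injection $S\to V$ mapping each element to a neighbour (a matching covering $S$). $\mathcal{P}(\mathcal{M})$ is the convex hull of characteristic vectors of independent sets of $\mathcal{M}$. $p\cdot x$ is the coordinatewise product. $R(x)$ is the random set containing each $e$ independently with probability $x_e$.
   Formalization: The vectors p and x and the weights $\beta_i$ are rational rather than real. -}

module Defs where

open import Data.Bool using (Bool; true; false; if_then_else_; _∧_)
open import Data.Nat using (ℕ; zero; suc)
open import Data.Fin using (Fin; zero; suc)
open import Data.Fin.Properties using () renaming (_≟_ to _≟ᶠ_)
open import Data.Fin.Subset using (Subset; _∈_)
open import Data.Fin.Subset.Properties using (_∈?_)
open import Data.List using (List; []; _∷_; [_]; map; concatMap; foldr; filter; allFin)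
open import Data.Maybe using (Maybe; just; nothing)
open import Data.Rational using (ℚ; 0ℚ; 1ℚ; _+_; _*_; _-_; _÷_; _<_)
open import Data.Rational.Properties using (_<?_; pos⇒nonZero)
import Data.Rational as Q
open import Relation.Nullary using (does; yes; no)
open import Relation.Nullary.Decidable using (_×-dec_)

Σℚ : ∀ {a} {A : Set a} → List A → (A → ℚ) → ℚ
Σℚ xs f = foldr (λ x s → f x + s) 0ℚ xs

Πℚ : ∀ {a} {A : Set a} → List A → (A → ℚ) → ℚ
Πℚ xs f = foldr (λ x s → f x * s) 1ℚ xs

⟦_⟧ : Bool → ℚ
⟦ b ⟧ = if b then 1ℚ else 0ℚ

_∷ᶠ_ : ∀ {A : Set} {n} → A → (Fin n → A) → Fin (suc n) → A
(a ∷ᶠ g) zero = a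
(a ∷ᶠ g) (suc i) = g i

allFuns : ∀ {A : Set} (n : ℕ) → List A → List (Fin n → A)
allFuns zero xs = [ (λ ()) ]
allFuns (suc n) xs = concatMap (λ a → map (λ g → a ∷ᶠ g) (allFuns n xs)) xs

allMaybeFin : (m : ℕ) → List (Maybe (Fin m))
allMaybeFin m = nothing ∷ map just (allFin m)

divPos : (a q : ℚ) → 0ℚ < q → ℚ
divPos a q q>0 = _÷_ a q {{pos⇒nonZero q {{Q.positive q>0}}}}

-- Transversal matroid data.  E = Fin n, V = Fin k, bipartite graph
-- G : Fin n → Fin k → Bool.  A set S ⊆ E is independent iff there is an
-- injection v : S → V with G s (v s) for all s ∈ S.

IsMatchingInjection : ∀ {n k} → (Fin n → Fin k → Bool) → Subset n → (Fin n → Fin k) → Set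
IsMatchingInjection {n} G S v =
  (∀ (e : Fin n) → e ∈ S → G e (v e) ≡ true) ×
  (∀ (e e′ : Fin n) → e ∈ S → e′ ∈ S → v e ≡ v e′ → e ≡ e′)
  where open import Data.Product using (_×_)
        open import Relation.Binary.PropositionalEquality using (_≡_)

-- φ[B,A](b) : the a ∈ A with vA a = vB b, or nothing (= ⊥)
φ : ∀ {n k} (A : Subset n) (vA : Fin n → Fin k) (vB : Fin n → Fin k) → Fin n → Maybe (Fin n)
φ {n} A vA vB b with filter (λ a → (a ∈? A) ×-dec (vA a ≟ᶠ vB b)) (allFin n)
... | [] = nothing
... | a ∷ _ = just a

-- probability that the critical index c(f) takes the value o
-- (nothing is the "undefined" value used exactly when p_f x_f = 0)
critProb : ∀ {n m} (B : Fin m → Subset n) (β : Fin m → ℚ) (px : Fin n → ℚ)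
           → Fin n → Maybe (Fin m) → ℚ
critProb B β px f o with 0ℚ <? px f | o
... | yes pos | just i = divPos (β i * ⟦ does (f ∈? B i) ⟧) (px f) pos
... | yes pos | nothing = 0ℚ
... | no _ | just i = 0ℚ
... | no _ | nothing = 1ℚ

inΓ : ∀ {n m k} (px : Fin n → ℚ) (v : Fin m → Fin n → Fin k) (B : Fin m → Subset n)
      → (Fin n → Maybe (Fin m)) → Fin n → Fin n → Bool
inΓ px v B c e f with c e | c f
... | just i | just j =
      does (0ℚ <? px f) ∧ (if does (f ≟ᶠ e) then false else
        (φ (B i) (v i) (v j) f ≡ᵐ just e))
  where
    _≡ᵐ_ : Maybe (Fin _) → Maybe (Fin _) → Bool
    just a ≡ᵐ just b = does (a ≟ᶠ b)
    nothing ≡ᵐ nothing = true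
    _ ≡ᵐ _ = false
... | _ | _ = false

expectedΓLoad : ∀ {n m k} (p x : Fin n → ℚ) (β : Fin m → ℚ) (B : Fin m → Subset n)
                (v : Fin m → Fin n → Fin k) → Fin n → ℚ
expectedΓLoad {n} {m} p x β B v e =
  Σℚ (allFuns n (allMaybeFin m)) λ c →
  Σℚ (allFuns n (true ∷ false ∷ [])) λ R →
    (Πℚ (allFin n) (λ f → critProb B β px f (c f))) *
    (Πℚ (allFin n) (λ f → if R f then x f else 1ℚ - x f)) *
    Σℚ (allFin n) (λ f → ⟦ inΓ px v B c e f ⟧ * p f * ⟦ R f ⟧)
  where px = λ f → p f * x f

{-# OPTIONS --safe #-}
-- Fix the critical index c(e) = i.  An element f ≠ e can only lie in Γ(e) if c(f) = j for a
-- set B_j whose matching sends f to the vertex v^{B_i}(e); as c(f) is independent of c(e) and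
-- P[c(f) = j] · p_f x_f = β_j for f ∈ B_j, the expected contribution of f is at most
-- Σ_j β_j [f ∈ B_j, v^{B_j}(f) = v^{B_i}(e)].  Summed over f, every matching v^{B_j} hits that
-- vertex at most once, so the total is at most Σ_j β_j = 1.  Averaging over R(x) merely
-- replaces 1[f ∈ R(x)] by x_f.
module Submission where

open import Defs
open import Algebra.Bundles using (CommutativeMonoid)
open import Data.Bool using (Bool; true; false; _∧_; if_then_else_)
open import Data.Bool.Properties using (∧-identityʳ; ∧-zeroʳ; ∧-conicalˡ; ∧-conicalʳ)
open import Data.Empty using (⊥-elim)
open import Data.Fin using (Fin; zero; suc)
open import Data.Fin.Properties using (suc-injective) renaming (_≟_ to _≟ᶠ_)
open import Data.Fin.Subset using (Subset; _∈_)
open import Data.Fin.Subset.Properties using (_∈?_)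
open import Data.List using (List; []; _∷_; _++_; map; concatMap; filter; allFin)
open import Data.List.Membership.Propositional using () renaming (_∈_ to _∈ˡ_)
open import Data.List.Membership.Propositional.Properties using (∈-filter⁻)
open import Data.List.Properties using (foldr-map; map-tabulate)
open import Data.List.Relation.Unary.Any using (here)
open import Data.Maybe using (Maybe; just; nothing; maybe)
open import Data.Nat using (ℕ; zero; suc)
open import Data.Product using (Σ-syntax; _×_; _,_; proj₂)
open import Data.Rational using (ℚ; 0ℚ; 1ℚ; _+_; _*_; _-_; _≤_; _<_; 1/_)
import Data.Rational as ℚ
open import Data.Rational.Properties
open import Data.Rational.Solver using (module +-*-Solver)
open +-*-Solver using (solve; _:+_; _:-_; _:*_; _:=_; con)
open import Function using (_∘_; id; flip)
open import Relation.Binary.PropositionalEquality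
open import Relation.Nullary using (¬_; Dec; does; yes; no; contradiction)
open import Relation.Nullary.Decidable using (dec-true; _×-dec_)
open import Algebra.Properties.CommutativeSemigroup
  (CommutativeMonoid.commutativeSemigroup +-0-commutativeMonoid) using (interchange)
open import Algebra.Properties.CommutativeSemigroup
  (CommutativeMonoid.commutativeSemigroup *-1-commutativeMonoid) using (x∙yz≈y∙xz)

*-nonNeg : ∀ {a b} → 0ℚ ≤ a → 0ℚ ≤ b → 0ℚ ≤ a * b
*-nonNeg {a} {b} a≥0 b≥0 =
  nonNegative⁻¹ (a * b) {{nonNeg*nonNeg⇒nonNeg a {{ℚ.nonNegative a≥0}} b {{ℚ.nonNegative b≥0}}}}

*-monoˡ-≤-nonNeg′ : ∀ {r p q} → 0ℚ ≤ r → p ≤ q → r * p ≤ r * q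
*-monoˡ-≤-nonNeg′ {r} r≥0 = *-monoˡ-≤-nonNeg r {{ℚ.nonNegative r≥0}}

⟦⟧-nonNeg : ∀ b → 0ℚ ≤ ⟦ b ⟧
⟦⟧-nonNeg true  = nonNegative⁻¹ 1ℚ
⟦⟧-nonNeg false = ≤-refl

module _ {A : Set} where

  Σℚ-cong : ∀ xs {f g : A → ℚ} → (∀ a → f a ≡ g a) → Σℚ xs f ≡ Σℚ xs g
  Σℚ-cong []       f≗g = refl
  Σℚ-cong (a ∷ xs) f≗g = cong₂ _+_ (f≗g a) (Σℚ-cong xs f≗g)

  Σℚ-mono-≤ : ∀ xs {f g : A → ℚ} → (∀ a → f a ≤ g a) → Σℚ xs f ≤ Σℚ xs g
  Σℚ-mono-≤ []       f≤g = ≤-refl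
  Σℚ-mono-≤ (a ∷ xs) f≤g = +-mono-≤ (f≤g a) (Σℚ-mono-≤ xs f≤g)

  Σℚ-nonNeg : ∀ xs {f : A → ℚ} → (∀ a → 0ℚ ≤ f a) → 0ℚ ≤ Σℚ xs f
  Σℚ-nonNeg []       f≥0 = ≤-refl
  Σℚ-nonNeg (a ∷ xs) f≥0 = +-mono-≤ (f≥0 a) (Σℚ-nonNeg xs f≥0)

  Σℚ-0 : ∀ xs → Σℚ xs (λ (_ : A) → 0ℚ) ≡ 0ℚ
  Σℚ-0 []       = refl
  Σℚ-0 (a ∷ xs) = trans (+-identityˡ _) (Σℚ-0 xs)

  Σℚ-distrib-+ : ∀ xs (f g : A → ℚ) → Σℚ xs (λ a → f a + g a) ≡ Σℚ xs f + Σℚ xs g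
  Σℚ-distrib-+ []       f g = refl
  Σℚ-distrib-+ (a ∷ xs) f g =
    trans (cong (f a + g a +_) (Σℚ-distrib-+ xs f g)) (interchange (f a) (g a) _ _)

  Σℚ-++ : ∀ xs ys (f : A → ℚ) → Σℚ (xs ++ ys) f ≡ Σℚ xs f + Σℚ ys f
  Σℚ-++ []       ys f = sym (+-identityˡ _)
  Σℚ-++ (a ∷ xs) ys f = trans (cong (f a +_) (Σℚ-++ xs ys f)) (sym (+-assoc (f a) _ _))

  *-distribˡ-Σℚ : ∀ xs k (f : A → ℚ) → k * Σℚ xs f ≡ Σℚ xs (λ a → k * f a)
  *-distribˡ-Σℚ []       k f = *-zeroʳ k
  *-distribˡ-Σℚ (a ∷ xs) k f = trans (*-distribˡ-+ k (f a) _) (cong (k * f a +_) (*-distribˡ-Σℚ xs k f))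

  Σℚ-weighted-const : ∀ xs (w : A → ℚ) k → Σℚ xs w ≡ 1ℚ → Σℚ xs (λ a → w a * k) ≡ k
  Σℚ-weighted-const xs w k Σw≡1 = begin
    Σℚ xs (λ a → w a * k) ≡⟨ Σℚ-cong xs (λ a → *-comm (w a) k) ⟩
    Σℚ xs (λ a → k * w a) ≡⟨ *-distribˡ-Σℚ xs k w ⟨
    k * Σℚ xs w           ≡⟨ cong (k *_) Σw≡1 ⟩
    k * 1ℚ                ≡⟨ *-identityʳ k ⟩
    k                     ∎
    where open ≡-Reasoning

  Σℚ-weighted-≤ : ∀ xs {w g : A → ℚ} {k} → (∀ a → 0ℚ ≤ w a) → Σℚ xs w ≡ 1ℚ →
                  (∀ a → g a ≤ k) → Σℚ xs (λ a → w a * g a) ≤ k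
  Σℚ-weighted-≤ xs {w} {g} {k} w≥0 Σw≡1 g≤k = begin
    Σℚ xs (λ a → w a * g a) ≤⟨ Σℚ-mono-≤ xs (λ a → *-monoˡ-≤-nonNeg′ (w≥0 a) (g≤k a)) ⟩
    Σℚ xs (λ a → w a * k)   ≡⟨ Σℚ-weighted-const xs w k Σw≡1 ⟩
    k                       ∎
    where open ≤-Reasoning

module _ {A B : Set} where

  Σℚ-map : ∀ (g : A → B) xs (f : B → ℚ) → Σℚ (map g xs) f ≡ Σℚ xs (f ∘ g)
  Σℚ-map g xs f = foldr-map _ g 0ℚ xs

  Πℚ-map : ∀ (g : A → B) xs (f : B → ℚ) → Πℚ (map g xs) f ≡ Πℚ xs (f ∘ g)
  Πℚ-map g xs f = foldr-map _ g 1ℚ xs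

  Σℚ-concatMap : ∀ (g : A → List B) xs (f : B → ℚ) →
                 Σℚ (concatMap g xs) f ≡ Σℚ xs (λ a → Σℚ (g a) f)
  Σℚ-concatMap g []       f = refl
  Σℚ-concatMap g (a ∷ xs) f =
    trans (Σℚ-++ (g a) (concatMap g xs) f) (cong (Σℚ (g a) f +_) (Σℚ-concatMap g xs f))

  Σℚ-comm : ∀ xs ys (h : A → B → ℚ) →
            Σℚ xs (λ a → Σℚ ys (h a)) ≡ Σℚ ys (λ b → Σℚ xs (λ a → h a b))
  Σℚ-comm []       ys h = sym (Σℚ-0 ys)
  Σℚ-comm (a ∷ xs) ys h =
    trans (cong (Σℚ ys (h a) +_) (Σℚ-comm xs ys h)) (sym (Σℚ-distrib-+ ys (h a) _))

  Σℚ-weighted-comm : ∀ xs ys (u : A → ℚ) (w : B → ℚ) (K : A → B → ℚ) →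
    Σℚ xs (λ a → u a * Σℚ ys (λ b → w b * K a b)) ≡ Σℚ ys (λ b → w b * Σℚ xs (λ a → u a * K a b))
  Σℚ-weighted-comm xs ys u w K = begin
    Σℚ xs (λ a → u a * Σℚ ys (λ b → w b * K a b))
      ≡⟨ Σℚ-cong xs (λ a → *-distribˡ-Σℚ ys (u a) _) ⟩
    Σℚ xs (λ a → Σℚ ys (λ b → u a * (w b * K a b)))
      ≡⟨ Σℚ-comm xs ys (λ a b → u a * (w b * K a b)) ⟩
    Σℚ ys (λ b → Σℚ xs (λ a → u a * (w b * K a b)))
      ≡⟨ Σℚ-cong ys (λ b → Σℚ-cong xs (λ a → x∙yz≈y∙xz (u a) (w b) (K a b))) ⟩
    Σℚ ys (λ b → Σℚ xs (λ a → w b * (u a * K a b)))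
      ≡⟨ Σℚ-cong ys (λ b → *-distribˡ-Σℚ xs (w b) _) ⟨
    Σℚ ys (λ b → w b * Σℚ xs (λ a → u a * K a b))
      ∎
    where open ≡-Reasoning

Σℚ-allFin-suc : ∀ {n} (f : Fin (suc n) → ℚ) → Σℚ (allFin (suc n)) f ≡ f zero + Σℚ (allFin n) (f ∘ suc)
Σℚ-allFin-suc {n} f =
  cong (f zero +_) (trans (cong (λ xs → Σℚ xs f) (sym (map-tabulate id suc))) (Σℚ-map suc (allFin n) f))

Πℚ-allFin-suc : ∀ {n} (f : Fin (suc n) → ℚ) → Πℚ (allFin (suc n)) f ≡ f zero * Πℚ (allFin n) (f ∘ suc)
Πℚ-allFin-suc {n} f =
  cong (f zero *_) (trans (cong (λ xs → Πℚ xs f) (sym (map-tabulate id suc))) (Πℚ-map suc (allFin n) f))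

Σℚ-allMaybeFin : ∀ {m} (f : Maybe (Fin m) → ℚ) →
                 Σℚ (allMaybeFin m) f ≡ f nothing + Σℚ (allFin m) (f ∘ just)
Σℚ-allMaybeFin {m} f = cong (f nothing +_) (Σℚ-map just (allFin m) f)

module ProductMeasure {A : Set} (outcomes : List A) where

  Normalised : ∀ {n} → (Fin n → A → ℚ) → Set
  Normalised w = ∀ f → Σℚ outcomes (w f) ≡ 1ℚ

  weight : ∀ {n} → (Fin n → A → ℚ) → (Fin n → A) → ℚ
  weight {n} w c = Πℚ (allFin n) (λ f → w f (c f))

  𝔼 : ∀ {n} → (Fin n → A → ℚ) → ((Fin n → A) → ℚ) → ℚ
  𝔼 {n} w F = Σℚ (allFuns n outcomes) (λ c → weight w c * F c)

  𝔼-cong : ∀ {n} (w : Fin n → A → ℚ) {F G : (Fin n → A) → ℚ} → (∀ c → F c ≡ G c) → 𝔼 w F ≡ 𝔼 w G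
  𝔼-cong {n} w F≗G = Σℚ-cong (allFuns n outcomes) (λ c → cong (weight w c *_) (F≗G c))

  𝔼-suc : ∀ {n} (w : Fin (suc n) → A → ℚ) F →
          𝔼 w F ≡ Σℚ outcomes (λ a → w zero a * 𝔼 (w ∘ suc) (λ g → F (a ∷ᶠ g)))
  𝔼-suc {n} w F = begin
    𝔼 w F
      ≡⟨ Σℚ-concatMap (λ a → map (a ∷ᶠ_) (allFuns n outcomes)) outcomes (λ c → weight w c * F c) ⟩
    Σℚ outcomes (λ a → Σℚ (map (a ∷ᶠ_) (allFuns n outcomes)) (λ c → weight w c * F c))
      ≡⟨ Σℚ-cong outcomes (λ a → Σℚ-map (a ∷ᶠ_) (allFuns n outcomes) (λ c → weight w c * F c)) ⟩
    Σℚ outcomes (λ a → Σℚ (allFuns n outcomes) (λ g → weight w (a ∷ᶠ g) * F (a ∷ᶠ g)))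
      ≡⟨ Σℚ-cong outcomes (λ a → Σℚ-cong (allFuns n outcomes) (peel a)) ⟩
    Σℚ outcomes (λ a → Σℚ (allFuns n outcomes) (λ g → w zero a * (weight (w ∘ suc) g * F (a ∷ᶠ g))))
      ≡⟨ Σℚ-cong outcomes (λ a → *-distribˡ-Σℚ (allFuns n outcomes) (w zero a) _) ⟨
    Σℚ outcomes (λ a → w zero a * 𝔼 (w ∘ suc) (λ g → F (a ∷ᶠ g)))
      ∎
    where
    open ≡-Reasoning
    peel : ∀ a g → weight w (a ∷ᶠ g) * F (a ∷ᶠ g) ≡ w zero a * (weight (w ∘ suc) g * F (a ∷ᶠ g))
    peel a g = trans (cong (_* F (a ∷ᶠ g)) (Πℚ-allFin-suc (λ f → w f ((a ∷ᶠ g) f))))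
                     (*-assoc (w zero a) (weight (w ∘ suc) g) (F (a ∷ᶠ g)))

  𝔼-distrib-Σℚ : ∀ {B : Set} {n} (w : Fin n → A → ℚ) (xs : List B) (F : B → (Fin n → A) → ℚ) →
                 𝔼 w (λ c → Σℚ xs (λ b → F b c)) ≡ Σℚ xs (λ b → 𝔼 w (F b))
  𝔼-distrib-Σℚ {n = n} w xs F =
    trans (Σℚ-cong (allFuns n outcomes) (λ c → *-distribˡ-Σℚ xs (weight w c) (λ b → F b c)))
          (Σℚ-comm (allFuns n outcomes) xs (λ c b → weight w c * F b c))

  𝔼-const : ∀ {n} (w : Fin n → A → ℚ) → Normalised w → ∀ k → 𝔼 w (λ _ → k) ≡ k
  𝔼-const {zero}  w Σw≡1 k = trans (+-identityʳ _) (*-identityˡ k)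
  𝔼-const {suc n} w Σw≡1 k = begin
    𝔼 w (λ _ → k)
      ≡⟨ 𝔼-suc w _ ⟩
    Σℚ outcomes (λ a → w zero a * 𝔼 (w ∘ suc) (λ _ → k))
      ≡⟨ Σℚ-cong outcomes (λ a → cong (w zero a *_) (𝔼-const (w ∘ suc) (Σw≡1 ∘ suc) k)) ⟩
    Σℚ outcomes (λ a → w zero a * k)
      ≡⟨ Σℚ-weighted-const outcomes (w zero) k (Σw≡1 zero) ⟩
    k ∎
    where open ≡-Reasoning

  𝔼-coordinate : ∀ {n} (w : Fin n → A → ℚ) → Normalised w → ∀ j (h : A → ℚ) →
                 𝔼 w (λ c → h (c j)) ≡ Σℚ outcomes (λ a → w j a * h a)
  𝔼-coordinate {suc n} w Σw≡1 zero h =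
    trans (𝔼-suc w _)
          (Σℚ-cong outcomes (λ a → cong (w zero a *_) (𝔼-const (w ∘ suc) (Σw≡1 ∘ suc) (h a))))
  𝔼-coordinate {suc n} w Σw≡1 (suc j) h =
    trans (𝔼-suc w _)
      (trans (Σℚ-cong outcomes (λ a → cong (w zero a *_) (𝔼-coordinate (w ∘ suc) (Σw≡1 ∘ suc) j h)))
             (Σℚ-weighted-const outcomes (w zero) _ (Σw≡1 zero)))

  𝔼-pair : ∀ {n} (w : Fin n → A → ℚ) → Normalised w → ∀ {i j} → i ≢ j → (K : A → A → ℚ) →
           𝔼 w (λ c → K (c i) (c j)) ≡ Σℚ outcomes (λ a → w i a * Σℚ outcomes (λ b → w j b * K a b))
  𝔼-pair w Σw≡1 {zero} {zero} i≢j K = ⊥-elim (i≢j refl)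
  𝔼-pair {suc n} w Σw≡1 {zero} {suc j} i≢j K =
    trans (𝔼-suc w _)
          (Σℚ-cong outcomes (λ a → cong (w zero a *_) (𝔼-coordinate (w ∘ suc) (Σw≡1 ∘ suc) j (K a))))
  𝔼-pair {suc n} w Σw≡1 {suc i} {zero} i≢j K =
    trans (𝔼-pair w Σw≡1 (i≢j ∘ sym) (flip K))
          (Σℚ-weighted-comm outcomes outcomes (w zero) (w (suc i)) (flip K))
  𝔼-pair {suc n} w Σw≡1 {suc i} {suc j} i≢j K =
    trans (𝔼-suc w _)
      (trans (Σℚ-cong outcomes (λ a →
                cong (w zero a *_) (𝔼-pair (w ∘ suc) (Σw≡1 ∘ suc) (i≢j ∘ cong suc) K)))
             (Σℚ-weighted-const outcomes (w zero) _ (Σw≡1 zero)))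

bernoulli : ∀ {n} → (Fin n → ℚ) → Fin n → Bool → ℚ
bernoulli x f b = if b then x f else 1ℚ - x f

module _ {n} (x : Fin n → ℚ) where
  open ProductMeasure (true ∷ false ∷ [])

  bernoulli-normalised : Normalised (bernoulli x)
  bernoulli-normalised f = solve 1 (λ y → y :+ ((con 1ℚ :- y) :+ con 0ℚ) := con 1ℚ) refl (x f)

  𝔼-bernoulli-Σℚ : ∀ (g : Fin n → ℚ) →
    𝔼 (bernoulli x) (λ R → Σℚ (allFin n) (λ f → g f * ⟦ R f ⟧)) ≡ Σℚ (allFin n) (λ f → g f * x f)
  𝔼-bernoulli-Σℚ g =
    trans (𝔼-distrib-Σℚ (bernoulli x) (allFin n) (λ f R → g f * ⟦ R f ⟧))
          (Σℚ-cong (allFin n) λ f →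
            trans (𝔼-coordinate (bernoulli x) bernoulli-normalised f (λ b → g f * ⟦ b ⟧))
                  (solve 2 (λ y z → y :* (z :* con 1ℚ) :+ ((con 1ℚ :- y) :* (z :* con 0ℚ) :+ con 0ℚ)
                                    := z :* y)
                         refl (x f) (g f)))

divPos-*-cancel : ∀ a q (q>0 : 0ℚ < q) → divPos a q q>0 * q ≡ a
divPos-*-cancel a q q>0 = begin
  a * 1/ q * q   ≡⟨ *-assoc a (1/ q) q ⟩
  a * (1/ q * q) ≡⟨ cong (a *_) (*-inverseˡ q) ⟩
  a * 1ℚ         ≡⟨ *-identityʳ a ⟩
  a              ∎
  where
  open ≡-Reasoning
  instance _ = pos⇒nonZero q {{ℚ.positive q>0}}

divPos-nonNeg : ∀ {a} q (q>0 : 0ℚ < q) → 0ℚ ≤ a → 0ℚ ≤ divPos a q q>0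
divPos-nonNeg q q>0 a≥0 = *-nonNeg a≥0 (nonNegative⁻¹ (1/ q) {{pos⇒nonNeg (1/ q) {{1/pos⇒pos q}}}})
  where instance _ = ℚ.positive q>0
                 _ = pos⇒nonZero q

module _ {n m} (B : Fin m → Subset n) (β : Fin m → ℚ) (px : Fin n → ℚ) (f : Fin n) where

  critProb-pos : (px>0 : 0ℚ < px f) →
                 ∀ o → critProb B β px f o ≡
                       maybe (λ i → divPos (β i * ⟦ does (f ∈? B i) ⟧) (px f) px>0) 0ℚ o
  critProb-pos px>0 o with 0ℚ <? px f | o
  ... | yes _    | just _  = refl
  ... | yes _    | nothing = refl
  ... | no px≯0  | _       = ⊥-elim (px≯0 px>0)

  critProb-nonPos : ¬ 0ℚ < px f → ∀ o → critProb B β px f o ≡ maybe (λ _ → 0ℚ) 1ℚ o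
  critProb-nonPos px≯0 o with 0ℚ <? px f | o
  ... | yes px>0 | _       = ⊥-elim (px≯0 px>0)
  ... | no _     | just _  = refl
  ... | no _     | nothing = refl

  critProb-just-* : 0ℚ < px f → ∀ i → critProb B β px f (just i) * px f ≡ β i * ⟦ does (f ∈? B i) ⟧
  critProb-just-* px>0 i =
    trans (cong (_* px f) (critProb-pos px>0 (just i))) (divPos-*-cancel _ (px f) px>0)

  critProb-nonNeg : (∀ i → 0ℚ ≤ β i) → ∀ o → 0ℚ ≤ critProb B β px f o
  critProb-nonNeg β≥0 o with 0ℚ <? px f | o
  ... | yes px>0 | just i  = divPos-nonNeg (px f) px>0 (*-nonNeg (β≥0 i) (⟦⟧-nonNeg _))
  ... | yes _    | nothing = ≤-refl
  ... | no _     | just _  = ≤-refl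
  ... | no _     | nothing = nonNegative⁻¹ 1ℚ

  critProb-normalised : px f ≡ Σℚ (allFin m) (λ i → β i * ⟦ does (f ∈? B i) ⟧) →
                        Σℚ (allMaybeFin m) (critProb B β px f) ≡ 1ℚ
  critProb-normalised px≡Σβ = by-cases (0ℚ <? px f)
    where
    by-cases : Dec (0ℚ < px f) → Σℚ (allMaybeFin m) (critProb B β px f) ≡ 1ℚ
    by-cases (yes px>0) = begin
      Σℚ (allMaybeFin m) (critProb B β px f)
        ≡⟨ Σℚ-allMaybeFin (critProb B β px f) ⟩
      critProb B β px f nothing + Σℚ (allFin m) (critProb B β px f ∘ just)
        ≡⟨ cong₂ _+_ (critProb-pos px>0 nothing) (Σℚ-cong (allFin m) (critProb-pos px>0 ∘ just)) ⟩
      0ℚ + Σℚ (allFin m) (λ i → a i * 1/ px f)  ≡⟨ +-identityˡ _ ⟩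
      Σℚ (allFin m) (λ i → a i * 1/ px f)       ≡⟨ Σℚ-cong (allFin m) (λ i → *-comm (a i) (1/ px f)) ⟩
      Σℚ (allFin m) (λ i → 1/ px f * a i)       ≡⟨ *-distribˡ-Σℚ (allFin m) (1/ px f) a ⟨
      1/ px f * Σℚ (allFin m) a                 ≡⟨ cong (1/ px f *_) px≡Σβ ⟨
      1/ px f * px f                            ≡⟨ *-inverseˡ (px f) ⟩
      1ℚ                                        ∎
      where
      open ≡-Reasoning
      instance _ = pos⇒nonZero (px f) {{ℚ.positive px>0}}
      a : Fin m → ℚ
      a i = β i * ⟦ does (f ∈? B i) ⟧
    by-cases (no px≯0) = begin
      Σℚ (allMaybeFin m) (critProb B β px f)
        ≡⟨ Σℚ-allMaybeFin (critProb B β px f) ⟩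
      critProb B β px f nothing + Σℚ (allFin m) (critProb B β px f ∘ just)
        ≡⟨ cong₂ _+_ (critProb-nonPos px≯0 nothing) (Σℚ-cong (allFin m) (critProb-nonPos px≯0 ∘ just)) ⟩
      1ℚ + Σℚ (allFin m) (λ _ → 0ℚ)   ≡⟨ cong (1ℚ +_) (Σℚ-0 (allFin m)) ⟩
      1ℚ + 0ℚ                        ≡⟨ +-identityʳ 1ℚ ⟩
      1ℚ                             ∎
      where open ≡-Reasoning

does≡true⇒ : ∀ {P : Set} (P? : Dec P) → does P? ≡ true → P
does≡true⇒ (yes p) _ = p

φ-just⇒sameVertex : ∀ {n k} (A : Subset n) (vA vB : Fin n → Fin k) {b a} →
                    φ A vA vB b ≡ just a → vA a ≡ vB b
φ-just⇒sameVertex {n} A vA vB {b} φ≡a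
  with filter (λ a → (a ∈? A) ×-dec (vA a ≟ᶠ vB b)) (allFin n) in filter≡
φ-just⇒sameVertex {n} A vA vB {b} refl | a ∷ _ =
  proj₂ (proj₂ (∈-filter⁻ (λ a → (a ∈? A) ×-dec (vA a ≟ᶠ vB b)) {xs = allFin n}
                          (subst (a ∈ˡ_) (sym filter≡) (here refl))))

module _ {n m k} (px : Fin n → ℚ) (v : Fin m → Fin n → Fin k) (B : Fin m → Subset n) where

  inΓ-local : ∀ (c c′ : Fin n → Maybe (Fin m)) {e f} → c e ≡ c′ e → c f ≡ c′ f →
              inΓ px v B c e f ≡ inΓ px v B c′ e f
  inΓ-local c c′ {e} {f} ce≡ cf≡ with c e | c′ e | c f | c′ f | ce≡ | cf≡
  ... | _ | _ | _ | _ | refl | refl = refl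

  inΓ-irrefl : ∀ c e → inΓ px v B c e e ≡ false
  inΓ-irrefl c e with c e
  ... | nothing = refl
  ... | just i with e ≟ᶠ e
  ...   | yes _   = ∧-zeroʳ _
  ...   | no e≢e  = ⊥-elim (e≢e refl)

  inΓ⇒sharedVertex : ∀ c e f → inΓ px v B c e f ≡ true →
    Σ[ i ∈ Fin m ] Σ[ j ∈ Fin m ] c e ≡ just i × c f ≡ just j × 0ℚ < px f × v i e ≡ v j f
  inΓ⇒sharedVertex c e f f∈Γ with c e | c f
  ... | nothing | _       = contradiction f∈Γ λ ()
  ... | just i  | nothing = contradiction f∈Γ λ ()
  ... | just i  | just j with ∧-conicalʳ (does (0ℚ <? px f)) _ f∈Γ
  ...   | f∈φ with f ≟ᶠ e | φ (B i) (v i) (v j) f in φ≡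
  ...     | yes _ | _       = contradiction f∈φ λ ()
  ...     | no _  | nothing = contradiction f∈φ λ ()
  ...     | no _  | just a with a ≟ᶠ e
  ...       | no _     = contradiction f∈φ λ ()
  ...       | yes refl = i , j , refl , refl , does≡true⇒ (0ℚ <? px f) (∧-conicalˡ _ _ f∈Γ)
                       , φ-just⇒sameVertex (B i) (v i) (v j) φ≡

Σℚ-⟦⟧-≤1 : ∀ {n} (P : Fin n → Bool) → (∀ f f′ → P f ≡ true → P f′ ≡ true → f ≡ f′) →
           Σℚ (allFin n) (λ f → ⟦ P f ⟧) ≤ 1ℚ
Σℚ-⟦⟧-≤1 {zero}  P unique = nonNegative⁻¹ 1ℚ
Σℚ-⟦⟧-≤1 {suc n} P unique rewrite Σℚ-allFin-suc (λ f → ⟦ P f ⟧) with P zero in P0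
... | true  = ≤-reflexive (trans (cong (1ℚ +_) (trans (Σℚ-cong (allFin n) rest-false) (Σℚ-0 (allFin n))))
                                 (+-identityʳ 1ℚ))
  where
  rest-false : ∀ f → ⟦ P (suc f) ⟧ ≡ 0ℚ
  rest-false f with P (suc f) in Pf
  ... | false = refl
  ... | true  = contradiction (unique zero (suc f) P0 Pf) λ ()
... | false = ≤-trans (≤-reflexive (+-identityˡ _))
                      (Σℚ-⟦⟧-≤1 (P ∘ suc) (λ f f′ Pf Pf′ → suc-injective (unique (suc f) (suc f′) Pf Pf′)))

matchingInjection-fibre-≤1 : ∀ {n k} {G : Fin n → Fin k → Bool} {S w} → IsMatchingInjection G S w →
  ∀ u → Σℚ (allFin n) (λ f → ⟦ does (f ∈? S) ∧ does (w f ≟ᶠ u) ⟧) ≤ 1ℚ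
matchingInjection-fibre-≤1 {S = S} {w} (_ , injective) u = Σℚ-⟦⟧-≤1 _ λ f f′ hf hf′ →
  injective f f′ (in-S f hf) (in-S f′ hf′) (trans (to-u f hf) (sym (to-u f′ hf′)))
  where
  in-S : ∀ f → does (f ∈? S) ∧ does (w f ≟ᶠ u) ≡ true → f ∈ S
  in-S f h = does≡true⇒ (f ∈? S) (∧-conicalˡ _ _ h)
  to-u : ∀ f → does (f ∈? S) ∧ does (w f ≟ᶠ u) ≡ true → w f ≡ u
  to-u f h = does≡true⇒ (w f ≟ᶠ u) (∧-conicalʳ _ _ h)

module ΓLoad {n k m} {G : Fin n → Fin k → Bool}
  (p x : Fin n → ℚ) (β : Fin m → ℚ) (B : Fin m → Subset n) (v : Fin m → Fin n → Fin k)
  (matching : ∀ i → IsMatchingInjection G (B i) (v i))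
  (β≥0 : ∀ i → 0ℚ ≤ β i) (Σβ≡1 : Σℚ (allFin m) β ≡ 1ℚ)
  (px≡Σβ : ∀ f → p f * x f ≡ Σℚ (allFin m) (λ i → β i * ⟦ does (f ∈? B i) ⟧))
  (e : Fin n) where

  open ProductMeasure (allMaybeFin m)

  px : Fin n → ℚ
  px f = p f * x f

  critical : Fin n → Maybe (Fin m) → ℚ
  critical = critProb B β px

  critical-nonNeg : ∀ f o → 0ℚ ≤ critical f o
  critical-nonNeg f = critProb-nonNeg B β px f β≥0

  critical-normalised : Normalised critical
  critical-normalised f = critProb-normalised B β px f (px≡Σβ f)

  Γ-term : (Fin n → Maybe (Fin m)) → Fin n → ℚ
  Γ-term c f = ⟦ inΓ px v B c e f ⟧ * p f * x f

  Γ-term-false : ∀ c f → inΓ px v B c e f ≡ false → Γ-term c f ≡ 0ℚ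
  Γ-term-false c f f∉Γ rewrite f∉Γ = trans (cong (_* x f) (*-zeroˡ (p f))) (*-zeroˡ (x f))

  Γ-term-true : ∀ c f → inΓ px v B c e f ≡ true → Γ-term c f ≡ px f
  Γ-term-true c f f∈Γ rewrite f∈Γ = cong (_* x f) (*-identityˡ (p f))

  expectedΓLoad≡𝔼 : expectedΓLoad p x β B v e ≡ 𝔼 critical (λ c → Σℚ (allFin n) (Γ-term c))
  expectedΓLoad≡𝔼 = Σℚ-cong (allFuns n (allMaybeFin m)) λ c →
    trans (Σℚ-cong (allFuns n Bools) (λ R → *-assoc (weight critical c) (weightᴿ R) _))
          (trans (sym (*-distribˡ-Σℚ (allFuns n Bools) (weight critical c) _))
                 (cong (weight critical c *_) (𝔼-bernoulli-Σℚ x (λ f → ⟦ inΓ px v B c e f ⟧ * p f))))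
    where
    Bools = true ∷ false ∷ []
    weightᴿ : (Fin n → Bool) → ℚ
    weightᴿ = ProductMeasure.weight Bools (bernoulli x)

  -- Given c(e) = i, the bound β_j · [v^{B_j}(f) = v^{B_i}(e)] on P[c(f) = j] · p_f x_f · [f ∈ Γ(e)].
  conflict : Maybe (Fin m) → Fin n → Maybe (Fin m) → ℚ
  conflict (just i) f (just j) = β j * ⟦ does (f ∈? B j) ∧ does (v j f ≟ᶠ v i e) ⟧
  conflict _        _ _        = 0ℚ

  conflict-nonNeg : ∀ a f b → 0ℚ ≤ conflict a f b
  conflict-nonNeg nothing  f b        = ≤-refl
  conflict-nonNeg (just i) f nothing  = ≤-refl
  conflict-nonNeg (just i) f (just j) = *-nonNeg (β≥0 j) (⟦⟧-nonNeg _)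

  critical-*-Γ-term-≤ : ∀ c {f a b} → c e ≡ a → c f ≡ b → critical f b * Γ-term c f ≤ conflict a f b
  critical-*-Γ-term-≤ c {f} refl refl = by-cases (inΓ px v B c e f) refl
    where
    by-cases : ∀ γ → inΓ px v B c e f ≡ γ → critical f (c f) * Γ-term c f ≤ conflict (c e) f (c f)
    by-cases false f∉Γ = begin
      critical f (c f) * Γ-term c f ≡⟨ cong (critical f (c f) *_) (Γ-term-false c f f∉Γ) ⟩
      critical f (c f) * 0ℚ         ≡⟨ *-zeroʳ (critical f (c f)) ⟩
      0ℚ                            ≤⟨ conflict-nonNeg (c e) f (c f) ⟩
      conflict (c e) f (c f)        ∎
      where open ≤-Reasoning
    by-cases true f∈Γ with inΓ⇒sharedVertex px v B c e f f∈Γ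
    ... | i , j , ce≡i , cf≡j , px>0 , same = ≤-reflexive (begin
      critical f (c f) * Γ-term c f      ≡⟨ cong₂ _*_ (cong (critical f) cf≡j) (Γ-term-true c f f∈Γ) ⟩
      critical f (just j) * px f         ≡⟨ critProb-just-* B β px f px>0 j ⟩
      β j * ⟦ does (f ∈? B j) ⟧          ≡⟨ cong (λ q → β j * ⟦ q ⟧) (∧-identityʳ _) ⟨
      β j * ⟦ does (f ∈? B j) ∧ true ⟧
        ≡⟨ cong (λ q → β j * ⟦ does (f ∈? B j) ∧ q ⟧) (dec-true (v j f ≟ᶠ v i e) (sym same)) ⟨
      conflict (just i) f (just j)       ≡⟨ cong₂ (λ a b → conflict a f b) ce≡i cf≡j ⟨
      conflict (c e) f (c f)             ∎)
      where open ≡-Reasoning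

  -- inΓ … c e f depends on c only through c e and c f, so it may be evaluated on this assignment.
  assignment : Maybe (Fin m) → Maybe (Fin m) → Fin n → Maybe (Fin m)
  assignment a b g = if does (g ≟ᶠ e) then a else b

  assignment-e : ∀ a b → assignment a b e ≡ a
  assignment-e a b with e ≟ᶠ e
  ... | yes _   = refl
  ... | no e≢e  = ⊥-elim (e≢e refl)

  assignment-≢e : ∀ a b {f} → f ≢ e → assignment a b f ≡ b
  assignment-≢e a b {f} f≢e with f ≟ᶠ e
  ... | yes f≡e = ⊥-elim (f≢e f≡e)
  ... | no _    = refl

  𝔼-Γ-term-≤ : ∀ f → 𝔼 critical (λ c → Γ-term c f) ≤
                     Σℚ (allMaybeFin m) (λ a → critical e a * Σℚ (allMaybeFin m) (conflict a f))
  𝔼-Γ-term-≤ f with f ≟ᶠ e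
  ... | yes refl = begin
    𝔼 critical (λ c → Γ-term c e) ≡⟨ 𝔼-cong critical (λ c → Γ-term-false c e (inΓ-irrefl px v B c e)) ⟩
    𝔼 critical (λ _ → 0ℚ)         ≡⟨ 𝔼-const critical critical-normalised 0ℚ ⟩
    0ℚ
      ≤⟨ Σℚ-nonNeg (allMaybeFin m) (λ a →
           *-nonNeg (critical-nonNeg e a) (Σℚ-nonNeg (allMaybeFin m) (conflict-nonNeg a e))) ⟩
    Σℚ (allMaybeFin m) (λ a → critical e a * Σℚ (allMaybeFin m) (conflict a e)) ∎
    where open ≤-Reasoning
  ... | no f≢e = begin
    𝔼 critical (λ c → Γ-term c f)
      ≡⟨ 𝔼-cong critical (λ c → cong (λ γ → ⟦ γ ⟧ * p f * x f)
           (inΓ-local px v B c (assignment (c e) (c f)) (sym (assignment-e _ _))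
                                                        (sym (assignment-≢e _ _ f≢e)))) ⟩
    𝔼 critical (λ c → K (c e) (c f))
      ≡⟨ 𝔼-pair critical critical-normalised (f≢e ∘ sym) K ⟩
    Σℚ (allMaybeFin m) (λ a → critical e a * Σℚ (allMaybeFin m) (λ b → critical f b * K a b))
      ≤⟨ Σℚ-mono-≤ (allMaybeFin m) (λ a → *-monoˡ-≤-nonNeg′ (critical-nonNeg e a)
           (Σℚ-mono-≤ (allMaybeFin m) (λ b →
              critical-*-Γ-term-≤ (assignment a b) (assignment-e a b) (assignment-≢e a b f≢e)))) ⟩
    Σℚ (allMaybeFin m) (λ a → critical e a * Σℚ (allMaybeFin m) (conflict a f)) ∎
    where
    open ≤-Reasoning
    K : Maybe (Fin m) → Maybe (Fin m) → ℚ
    K a b = Γ-term (assignment a b) f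

  Σ-conflict-≤1 : ∀ a → Σℚ (allFin n) (λ f → Σℚ (allMaybeFin m) (conflict a f)) ≤ 1ℚ
  Σ-conflict-≤1 nothing = begin
    Σℚ (allFin n) (λ f → Σℚ (allMaybeFin m) (λ _ → 0ℚ)) ≡⟨ Σℚ-cong (allFin n) (λ _ → Σℚ-0 (allMaybeFin m)) ⟩
    Σℚ (allFin n) (λ _ → 0ℚ)                            ≡⟨ Σℚ-0 (allFin n) ⟩
    0ℚ                                                  ≤⟨ nonNegative⁻¹ 1ℚ ⟩
    1ℚ                                                  ∎
    where open ≤-Reasoning
  Σ-conflict-≤1 (just i) = begin
    Σℚ (allFin n) (λ f → Σℚ (allMaybeFin m) (conflict (just i) f))
      ≡⟨ Σℚ-cong (allFin n) (λ f → trans (Σℚ-allMaybeFin (conflict (just i) f))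
                                          (+-identityˡ (Σℚ (allFin m) (conflict (just i) f ∘ just)))) ⟩
    Σℚ (allFin n) (λ f → Σℚ (allFin m) (λ j → β j * ⟦ matched j f ⟧))
      ≡⟨ Σℚ-comm (allFin n) (allFin m) (λ f j → β j * ⟦ matched j f ⟧) ⟩
    Σℚ (allFin m) (λ j → Σℚ (allFin n) (λ f → β j * ⟦ matched j f ⟧))
      ≡⟨ Σℚ-cong (allFin m) (λ j → *-distribˡ-Σℚ (allFin n) (β j) (λ f → ⟦ matched j f ⟧)) ⟨
    Σℚ (allFin m) (λ j → β j * Σℚ (allFin n) (λ f → ⟦ matched j f ⟧))
      ≤⟨ Σℚ-weighted-≤ (allFin m) β≥0 Σβ≡1 (λ j →
           matchingInjection-fibre-≤1 {G = G} (matching j) (v i e)) ⟩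
    1ℚ ∎
    where
    open ≤-Reasoning
    matched : Fin m → Fin n → Bool
    matched j f = does (f ∈? B j) ∧ does (v j f ≟ᶠ v i e)

lemma8 : (n k m : ℕ) (G : Fin n → Fin k → Bool)
    (p x : Fin n → ℚ) (β : Fin m → ℚ) (B : Fin m → Subset n) (v : Fin m → Fin n → Fin k)
    → (∀ e → 0ℚ ≤ p e) → (∀ e → p e ≤ 1ℚ)
    → (∀ e → 0ℚ ≤ x e) → (∀ e → x e ≤ 1ℚ)
    → (∀ i → IsMatchingInjection G (B i) (v i))
    → (∀ i → 0ℚ ≤ β i)
    → Σℚ (allFin m) β ≡ 1ℚ
    → (∀ e → p e * x e ≡ Σℚ (allFin m) (λ i → β i * ⟦ does (e ∈? B i) ⟧))
    → ∀ e → 0ℚ < p e * x e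
    → expectedΓLoad p x β B v e ≤ 1ℚ
lemma8 n k m G p x β B v _ _ _ _ matching β≥0 Σβ≡1 px≡Σβ e _ = begin
  expectedΓLoad p x β B v e
    ≡⟨ expectedΓLoad≡𝔼 ⟩
  𝔼 critical (λ c → Σℚ (allFin n) (Γ-term c))
    ≡⟨ 𝔼-distrib-Σℚ critical (allFin n) (λ f c → Γ-term c f) ⟩
  Σℚ (allFin n) (λ f → 𝔼 critical (λ c → Γ-term c f))
    ≤⟨ Σℚ-mono-≤ (allFin n) 𝔼-Γ-term-≤ ⟩
  Σℚ (allFin n) (λ f → Σℚ (allMaybeFin m) (λ a → critical e a * Σℚ (allMaybeFin m) (conflict a f)))
    ≡⟨ Σℚ-comm (allFin n) (allMaybeFin m) (λ f a → critical e a * Σℚ (allMaybeFin m) (conflict a f)) ⟩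
  Σℚ (allMaybeFin m) (λ a → Σℚ (allFin n) (λ f → critical e a * Σℚ (allMaybeFin m) (conflict a f)))
    ≡⟨ Σℚ-cong (allMaybeFin m) (λ a → *-distribˡ-Σℚ (allFin n) (critical e a) _) ⟨
  Σℚ (allMaybeFin m) (λ a → critical e a * Σℚ (allFin n) (λ f → Σℚ (allMaybeFin m) (conflict a f)))
    ≤⟨ Σℚ-weighted-≤ (allMaybeFin m) (critical-nonNeg e) (critical-normalised e) Σ-conflict-≤1 ⟩
  1ℚ ∎
  where
  open ≤-Reasoning
  open ΓLoad {G = G} p x β B v matching β≥0 Σβ≡1 px≡Σβ e
  open ProductMeasure (allMaybeFin m)
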